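{- Let $n\geqslant1$, let $v>2$ be an even positive divisor of $n$, and $l=n/v$. Let $H\subseteq\{1,\dots,v-1\}\subseteq\mathbb{Z}_n$ and $X\subseteq\mathbb{Z}_n$ satisfy: (i) $X=H+v\mathbb{Z}_n$; (ii) $X\uplus(-X)=(\mathbb{Z}_n\setminus v\mathbb{Z}_n)\uplus(\frac v2+v\mathbb{Z}_n)$ as multisets; (iii) $X\cup(\frac v2+X)=\mathbb{Z}_n$. Then $Dih(n,X,X)$ is a DSRG with parameters $\left(2n,\,n,\,\frac n2+l,\,\frac n2-l,\,\frac n2+l\right)$.
   Context: $D_n=\langle x,a\mid x^n=1,\ a^2=1,\ ax=x^{ -1}a\rangle$; $Dih(n,X,Y)$ is the Cayley digraph on $D_n$ with connection set $\{x^i:i\in X\}\cup\{x^ja:j\in Y\}$. A DSRG with parameters $(N,k,\mu,\lambda,t)$: adjacency matrix $A$ with $AJ=JA=kJ$ and $A^2=tI+\lambda A+\mu(J-I-A)$. $v\mathbb{Z}_n$ is the subgroup of multiples of $v$; $c+A=\{c+a:a\in A\}$; $\uplus$ is multiset union (multiplicities add). -}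

module Defs where

open import Data.Nat using (ℕ; zero; suc; _+_; _*_; _∸_; _/_; _%_; NonZero)
open import Data.Nat.DivMod using (_mod_)
open import Data.Fin using (Fin; toℕ)
import Data.Fin.Properties as FinP
open import Data.Bool using (Bool; true; false; _∧_; _∨_; not; if_then_else_)
import Data.Bool.Properties as BoolP
open import Data.List using (List; []; _∷_; map; _++_; allFin; upTo; length)
open import Data.Bool.ListAction using (any)
import Data.Product.Properties as ProdP
open import Data.Product using (_×_; _,_)
open import Data.Integer using (ℤ; +_) renaming (_+_ to _+ℤ_; _*_ to _*ℤ_; _-_ to _-ℤ_)
open import Relation.Nullary using (Dec; does)
open import Relation.Binary.PropositionalEquality using (_≡_)
open import Relation.Binary using (DecidableEquality)

count : {V : Set} → (V → Bool) → List V → ℕ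
count p []       = 0
count p (x ∷ xs) = (if p x then 1 else 0) + count p xs

ind : Bool → ℤ
ind true  = + 1
ind false = + 0

-- A digraph on vertex type V, with vertex enumeration `vs` (each vertex
-- listed exactly once) and adjacency `adj`, is a DSRG with parameters
-- (N, k, μ, λ, t):  N vertices, A J = J A = k J, and
-- A² = t I + λ A + μ (J - I - A)  (checked entrywise, in ℤ).
IsDSRG : {V : Set} → DecidableEquality V → List V → (V → V → Bool) →
         (N k μ λ' t : ℕ) → Set
IsDSRG {V} _≟_ vs adj N k μ λ' t =
    (length vs ≡ N)
  × ((u : V) → count (λ w → adj u w) vs ≡ k)
  × ((u : V) → count (λ w → adj w u) vs ≡ k)
  × ((u w : V) →
       + count (λ z → adj u z ∧ adj z w) vs
       ≡ ((+ t) *ℤ δ u w) +ℤ ((+ λ') *ℤ ind (adj u w))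
           +ℤ ((+ μ) *ℤ ((+ 1 -ℤ δ u w) -ℤ ind (adj u w))))
  where
  δ : V → V → ℤ
  δ u w = ind (does (u ≟ w))

module Zn (n : ℕ) .{{_ : NonZero n}} where

  _⊕_ : Fin n → Fin n → Fin n
  a ⊕ b = (toℕ a + toℕ b) mod n

  ⊖_ : Fin n → Fin n
  ⊖ a = (n ∸ toℕ a) mod n

  [_] : ℕ → Fin n
  [ m ] = m mod n

  Subset : Set
  Subset = Fin n → Bool

  elems : List (Fin n)
  elems = allFin n

  eqb : Fin n → Fin n → Bool
  eqb a b = does (a FinP.≟ b)

  sumset : Subset → Subset → Subset
  sumset A B z = any (λ a → any (λ b → A a ∧ B b ∧ eqb z (a ⊕ b)) elems) elems

  shift : Fin n → Subset → Subset
  shift c A z = any (λ a → A a ∧ eqb z (c ⊕ a)) elems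

  neg : Subset → Subset
  neg A z = any (λ a → A a ∧ eqb z (⊖ a)) elems

  -- v ℤ_n = { v m mod n : m ∈ ℕ }  (m < n suffices)
  multiples : ℕ → Subset
  multiples v z = any (λ m → eqb z [ v * m ]) (upTo n)

  compl : Subset → Subset
  compl A z = not (A z)

  -- multiplicity of z in a subset, used for multiset unions A ⊎ B
  mult : Subset → Fin n → ℕ
  mult A z = if A z then 1 else 0

-- Dihedral group D_n: (i , false) stands for x^i, (i , true) for x^i a.

module Dihedral (n : ℕ) .{{_ : NonZero n}} where
  open Zn n

  D : Set
  D = Fin n × Bool

  _≟D_ : DecidableEquality D
  _≟D_ = ProdP.≡-dec FinP._≟_ BoolP._≟_

  -- a x^j = x^{-j} a, hence (x^i a^s)(x^j a^t) = x^{i + (-1)^s j} a^{s+t}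
  _·_ : D → D → D
  (i , false) · (j , t) = (i ⊕ j , t)
  (i , true)  · (j , t) = (i ⊕ (⊖ j) , not t)

  inv : D → D
  inv (i , false) = (⊖ i , false)
  inv (i , true)  = (i , true)

  elemsD : List D
  elemsD = map (λ i → (i , false)) elems ++ map (λ i → (i , true)) elems

  inS : Subset → Subset → D → Bool
  inS X Y (i , false) = X i
  inS X Y (j , true)  = Y j

  DihAdj : Subset → Subset → D → D → Bool
  DihAdj X Y g h = inS X Y (inv g · h)

  DihIsDSRG : Subset → Subset → (N k μ λ' t : ℕ) → Set
  DihIsDSRG X Y = IsDSRG _≟D_ elemsD (DihAdj X Y)

-- Write M = vℤ_n and h = v/2, so that h ∉ M and 2h ∈ M. By (i) the set X is a union
-- of M-cosets, and (ii) at 0 gives 0 ∉ X, hence X ∩ M = ∅. If y and y + h were both in X,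
-- then (ii) would force −y and −y − h out of X, contradicting (iii) at −y; with (iii) at
-- y + h this shows that translation by h swaps X and its complement, so |X| = n/2.
-- In Dih(n, X, X) the arc from x^i a^s to x^j a^t is present iff a rotation index c lies
-- in X, and the number of 2-walks between them is Σ_{y ∈ X} m(y − c), where m is the
-- multiplicity function of X ⊎ (−X). By (ii) this is
--   |{y ∈ X : y − c ∉ M}| + |{y ∈ X : y − c − h ∈ M}| = (n/2 − l[c ∈ X]) + l[c + h ∈ X],
-- that is n/2 − l on arcs and n/2 + l elsewhere, which is the DSRG condition.

module Submission where

open import Defs
open import Data.Nat
  using (ℕ; zero; suc; pred; _+_; _*_; _∸_; _/_; _%_; _≤_; _<_; s≤s; z≤n;
         NonZero; ≢-nonZero; ≢-nonZero⁻¹; >-nonZero; >-nonZero⁻¹)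
open import Data.Nat.Properties
open import Data.Nat.DivMod
open import Data.Nat.Divisibility
  using (_∣_; _∣?_; divides; _∣0; ∣-refl; >⇒∤; ∣⇒≤; %-presˡ-∣; ∣n∣m%n⇒∣m; ∣m∣n⇒∣m+n; ∣m+n∣m⇒∣n; m∣m*n)
open import Data.Fin using (Fin; toℕ; zero; suc)
open import Data.Fin.Properties using (toℕ-fromℕ<; toℕ<n; toℕ-injective)
import Data.Fin.Properties as FinP
import Data.Fin.Permutation as Permutation
open import Data.Bool using (Bool; true; false; _∧_; _∨_; not; if_then_else_)
open import Data.Bool.Properties using (T-≡; ¬-not; ⇔→≡; ∧-identityʳ; ∨-identityʳ)
open import Data.Bool.ListAction using (any)
open import Data.List using (List; []; _∷_; _++_; map; tabulate; upTo; allFin; length)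
open import Data.List.Properties using (map-tabulate; length-++; length-map; length-tabulate)
open import Data.List.Membership.Propositional using (_∈_; lose)
open import Data.List.Membership.Propositional.Properties using (∈-allFin; ∈-upTo⁺)
open import Data.List.Relation.Unary.Any using (satisfied)
open import Data.List.Relation.Unary.Any.Properties using (any⁺; any⁻)
open import Data.Product using (_×_; _,_; ∃-syntax)
import Data.Integer as ℤ
open import Data.Integer.Tactic.RingSolver using (solve-∀)
open import Algebra.Bundles using (AbelianGroup)
import Algebra.Properties.AbelianGroup as AbelianGroupProperties
import Algebra.Properties.CommutativeSemigroup as CommutativeSemigroupProperties
open import Algebra.Properties.CommutativeMonoid.Sum +-0-commutativeMonoid
  using (sum-syntax; ∑-distrib-+; ∑-permute; sum-cong-≗; sum-replicate-zero)
open import Algebra.Properties.Semiring.Sum +-*-semiring using (*-distribˡ-sum)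
open import Function using (Equivalence; _⇔_; mk⇔; case_of_; _∘_; id)
open import Level using (0ℓ)
open import Relation.Nullary using (Dec; does; yes; ¬_)
open import Relation.Nullary.Decidable using (dec-true; dec-false; does-⇔)
open import Relation.Binary.PropositionalEquality hiding ([_])

⟦_⟧ : Bool → ℕ
⟦ b ⟧ = if b then 1 else 0

⟦⟧-∧ : ∀ a b → ⟦ a ∧ b ⟧ ≡ ⟦ a ⟧ * ⟦ b ⟧
⟦⟧-∧ true  b = sym (+-identityʳ ⟦ b ⟧)
⟦⟧-∧ false b = refl

⟦⟧-+-not : ∀ b → ⟦ b ⟧ + ⟦ not b ⟧ ≡ 1
⟦⟧-+-not true  = refl
⟦⟧-+-not false = refl

count-tabulate : ∀ {A : Set} {m} (p : A → Bool) (f : Fin m → A) →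
                 count p (tabulate f) ≡ ∑[ i < m ] ⟦ p (f i) ⟧
count-tabulate {m = zero}  p f = refl
count-tabulate {m = suc m} p f = cong (⟦ p (f zero) ⟧ +_) (count-tabulate p (f ∘ suc))

count-++ : ∀ {A : Set} (p : A → Bool) xs ys → count p (xs ++ ys) ≡ count p xs + count p ys
count-++ p []       ys = refl
count-++ p (x ∷ xs) ys = trans (cong (⟦ p x ⟧ +_) (count-++ p xs ys)) (sym (+-assoc ⟦ p x ⟧ _ _))

witness : ∀ {P : Set} (p? : Dec P) → does p? ≡ true → P
witness (yes p) _ = p

∧-trueʳ : ∀ {x y} → x ∧ y ≡ true → y ≡ true
∧-trueʳ {true} y≡true = y≡true

⟦⟧-injective : ∀ {a b} → ⟦ a ⟧ ≡ ⟦ b ⟧ → a ≡ b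
⟦⟧-injective {false} {false} _ = refl
⟦⟧-injective {true}  {true}  _ = refl

⟦⟧≡0 : ∀ {b} → ⟦ b ⟧ ≡ 0 → b ≡ false
⟦⟧≡0 {false} _ = refl

module _ {A : Set} where

  any-cong : {p q : A → Bool} → (∀ x → p x ≡ q x) → (xs : List A) → any p xs ≡ any q xs
  any-cong p≗q []       = refl
  any-cong p≗q (x ∷ xs) = cong₂ _∨_ (p≗q x) (any-cong p≗q xs)

  any-∧ˡ : ∀ c (p : A → Bool) xs → any (λ x → c ∧ p x) xs ≡ c ∧ any p xs
  any-∧ˡ true  p xs       = refl
  any-∧ˡ false p []       = refl
  any-∧ˡ false p (x ∷ xs) = any-∧ˡ false p xs

  any-true : ∀ {p : A → Bool} {x xs} → x ∈ xs → p x ≡ true → any p xs ≡ true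
  any-true {p} x∈xs px = Equivalence.to T-≡ (any⁺ p (lose x∈xs (Equivalence.from T-≡ px)))

  any-witness : ∀ (p : A → Bool) xs → any p xs ≡ true → ∃[ x ] p x ≡ true
  any-witness p xs any≡true with satisfied (any⁻ p xs (Equivalence.from T-≡ any≡true))
  ... | x , px = x , Equivalence.to T-≡ px

  any-unique : ∀ {p : A → Bool} {a xs} → a ∈ xs → (∀ b → p b ≡ true → b ≡ a) → any p xs ≡ p a
  any-unique {p} {a} {xs} a∈xs unique with p a in pa
  ... | true  = any-true a∈xs pa
  ... | false = ¬-not λ any≡true → let (b , pb) = any-witness p xs any≡true in
                  case trans (sym pa) (subst (λ c → p c ≡ true) (unique b pb) pb) of λ ()

∑-cong : ∀ {m} {f g : Fin m → ℕ} → (∀ i → f i ≡ g i) → ∑[ i < m ] f i ≡ ∑[ i < m ] g i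
∑-cong = sum-cong-≗

∑-reindex : ∀ {m} (f : Fin m → ℕ) {σ τ : Fin m → Fin m} →
            (∀ y → σ (τ y) ≡ y) → (∀ x → τ (σ x) ≡ x) → ∑[ i < m ] f i ≡ ∑[ i < m ] f (σ i)
∑-reindex f {σ} {τ} στ τσ = ∑-permute f (Permutation.permutation σ τ στ τσ)

∑-*ˡ : ∀ {m} k (f : Fin m → ℕ) → ∑[ i < m ] (k * f i) ≡ k * ∑[ i < m ] f i
∑-*ˡ k f = sym (*-distribˡ-sum k f)

∑-const-1 : ∀ m → ∑[ i < m ] 1 ≡ m
∑-const-1 zero    = refl
∑-const-1 (suc m) = cong suc (∑-const-1 m)

∑-toℕ-+ : ∀ a b (f : ℕ → ℕ) →
          ∑[ i < a + b ] f (toℕ i) ≡ ∑[ i < a ] f (toℕ i) + ∑[ i < b ] f (a + toℕ i)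
∑-toℕ-+ zero    b f = refl
∑-toℕ-+ (suc a) b f = trans (cong (f 0 +_) (∑-toℕ-+ a b (f ∘ suc))) (sym (+-assoc (f 0) _ _))

∑-divisible-block : ∀ v → ∑[ i < suc v ] ⟦ does (suc v ∣? toℕ i) ⟧ ≡ 1
∑-divisible-block v =
  cong₂ _+_ (cong ⟦_⟧ (dec-true (suc v ∣? 0) (suc v ∣0))) (trans (∑-cong {v} indivisible) (sum-replicate-zero v))
  where
  indivisible : ∀ i → ⟦ does (suc v ∣? suc (toℕ i)) ⟧ ≡ 0
  indivisible i = cong ⟦_⟧ (dec-false (suc v ∣? suc (toℕ i)) (>⇒∤ (s≤s (toℕ<n i))))

∑-divisible : ∀ v l → ∑[ i < suc v * l ] ⟦ does (suc v ∣? toℕ i) ⟧ ≡ l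
∑-divisible v zero    = cong (λ m → ∑[ i < m ] ⟦ does (suc v ∣? toℕ i) ⟧) (*-zeroʳ v)
∑-divisible v (suc l) = begin
  ∑[ i < w * suc l ] D (toℕ i)                          ≡⟨ cong (λ m → ∑[ i < m ] D (toℕ i)) (*-suc w l) ⟩
  ∑[ i < w + w * l ] D (toℕ i)                          ≡⟨ ∑-toℕ-+ w (w * l) D ⟩
  ∑[ i < w ] D (toℕ i) + ∑[ i < w * l ] D (w + toℕ i)  ≡⟨ cong₂ _+_ (∑-divisible-block v) (∑-cong {w * l} (λ i → D-+w (toℕ i))) ⟩
  1 + ∑[ i < w * l ] D (toℕ i)                          ≡⟨ cong suc (∑-divisible v l) ⟩
  suc l                                                 ∎
  where
  open ≡-Reasoning
  w = suc v
  D : ℕ → ℕ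
  D x = ⟦ does (w ∣? x) ⟧
  D-+w : ∀ x → D (w + x) ≡ D x
  D-+w x = cong ⟦_⟧ (does-⇔ (mk⇔ (λ w∣w+x → ∣m+n∣m⇒∣n w∣w+x ∣-refl) (∣m∣n⇒∣m+n ∣-refl)) (w ∣? (w + x)) (w ∣? x))

dsrg-entry : ∀ (d a : Bool) K m l → (d ≡ true → a ≡ false) → K + ⟦ a ⟧ * l ≡ m + ⟦ not a ⟧ * l →
  ℤ.+ K ≡ (ℤ.+ (m + l)) ℤ.* ind d ℤ.+ (ℤ.+ (m ∸ l)) ℤ.* ind a ℤ.+ (ℤ.+ (m + l)) ℤ.* ((ℤ.+ 1 ℤ.- ind d) ℤ.- ind a)
dsrg-entry true  true  K m l loopless _ = case loopless refl of λ ()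
dsrg-entry false true  K m l _ K+l≡m = trans (cong ℤ.+_ K≡m∸l) (arc (ℤ.+ (m + l)) (ℤ.+ (m ∸ l)))
  where
  K≡m∸l : K ≡ m ∸ l
  K≡m∸l = trans (sym (m+n∸n≡m K l)) (cong (_∸ l) (trans (cong (K +_) (sym (+-identityʳ l))) (trans K+l≡m (+-identityʳ m))))
  arc : ∀ μ λ′ → λ′ ≡ μ ℤ.* ℤ.+ 0 ℤ.+ λ′ ℤ.* ℤ.+ 1 ℤ.+ μ ℤ.* ((ℤ.+ 1 ℤ.- ℤ.+ 0) ℤ.- ℤ.+ 1)
  arc = solve-∀
dsrg-entry d     false K m l _ K+0≡m+l = trans (cong ℤ.+_ K≡m+l) (non-adjacent d (ℤ.+ (m + l)) (ℤ.+ (m ∸ l)))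
  where
  K≡m+l : K ≡ m + l
  K≡m+l = trans (sym (+-identityʳ K)) (trans K+0≡m+l (cong (m +_) (+-identityʳ l)))
  non-adjacent : ∀ d μ λ′ → μ ≡ μ ℤ.* ind d ℤ.+ λ′ ℤ.* ℤ.+ 0 ℤ.+ μ ℤ.* ((ℤ.+ 1 ℤ.- ind d) ℤ.- ℤ.+ 0)
  non-adjacent true  = solve-∀
  non-adjacent false = solve-∀

module ZnGroup (n : ℕ) .{{_ : NonZero n}} where
  open Zn n

  𝟘 : Fin n
  𝟘 = [ 0 ]

  toℕ-⊕ : ∀ a b → toℕ (a ⊕ b) ≡ (toℕ a + toℕ b) % n
  toℕ-⊕ a b = toℕ-fromℕ< _

  toℕ-⊖ : ∀ a → toℕ (⊖ a) ≡ (n ∸ toℕ a) % n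
  toℕ-⊖ a = toℕ-fromℕ< _

  toℕ-[] : ∀ m → toℕ [ m ] ≡ m % n
  toℕ-[] m = toℕ-fromℕ< _

  toℕ-𝟘 : toℕ 𝟘 ≡ 0
  toℕ-𝟘 = trans (toℕ-[] 0) (m<n⇒m%n≡m (>-nonZero⁻¹ n))

  [m%n+k]%n≡[m+k]%n : ∀ m k → (m % n + k) % n ≡ (m + k) % n
  [m%n+k]%n≡[m+k]%n m k = begin
    (m % n + k) % n          ≡⟨ %-distribˡ-+ (m % n) k n ⟩
    (m % n % n + k % n) % n  ≡⟨ cong (λ x → (x + k % n) % n) (m%n%n≡m%n m n) ⟩
    (m % n + k % n) % n      ≡⟨ %-distribˡ-+ m k n ⟨
    (m + k) % n              ∎
    where open ≡-Reasoning

  ⊕-comm : ∀ a b → a ⊕ b ≡ b ⊕ a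
  ⊕-comm a b = cong (_mod n) (+-comm (toℕ a) (toℕ b))

  ⊕-assoc : ∀ a b c → (a ⊕ b) ⊕ c ≡ a ⊕ (b ⊕ c)
  ⊕-assoc a b c = toℕ-injective (begin
    toℕ ((a ⊕ b) ⊕ c)                ≡⟨ toℕ-⊕ (a ⊕ b) c ⟩
    (toℕ (a ⊕ b) + toℕ c) % n        ≡⟨ cong (λ x → (x + toℕ c) % n) (toℕ-⊕ a b) ⟩
    ((toℕ a + toℕ b) % n + toℕ c) % n ≡⟨ [m%n+k]%n≡[m+k]%n (toℕ a + toℕ b) (toℕ c) ⟩
    (toℕ a + toℕ b + toℕ c) % n       ≡⟨ cong (_% n) (+-assoc (toℕ a) (toℕ b) (toℕ c)) ⟩
    (toℕ a + (toℕ b + toℕ c)) % n     ≡⟨ cong (_% n) (+-comm (toℕ a) (toℕ b + toℕ c)) ⟩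
    (toℕ b + toℕ c + toℕ a) % n       ≡⟨ [m%n+k]%n≡[m+k]%n (toℕ b + toℕ c) (toℕ a) ⟨
    ((toℕ b + toℕ c) % n + toℕ a) % n ≡⟨ cong (λ x → (x + toℕ a) % n) (toℕ-⊕ b c) ⟨
    (toℕ (b ⊕ c) + toℕ a) % n        ≡⟨ toℕ-⊕ (b ⊕ c) a ⟨
    toℕ ((b ⊕ c) ⊕ a)                ≡⟨ cong toℕ (⊕-comm (b ⊕ c) a) ⟩
    toℕ (a ⊕ (b ⊕ c))                ∎)
    where open ≡-Reasoning

  ⊕-identityˡ : ∀ a → 𝟘 ⊕ a ≡ a
  ⊕-identityˡ a = toℕ-injective (begin
    toℕ (𝟘 ⊕ a)            ≡⟨ toℕ-⊕ 𝟘 a ⟩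
    (toℕ 𝟘 + toℕ a) % n    ≡⟨ cong (λ x → (x + toℕ a) % n) toℕ-𝟘 ⟩
    toℕ a % n              ≡⟨ m<n⇒m%n≡m (toℕ<n a) ⟩
    toℕ a                  ∎)
    where open ≡-Reasoning

  ⊖-inverseˡ : ∀ a → (⊖ a) ⊕ a ≡ 𝟘
  ⊖-inverseˡ a = toℕ-injective (begin
    toℕ ((⊖ a) ⊕ a)                  ≡⟨ toℕ-⊕ (⊖ a) a ⟩
    (toℕ (⊖ a) + toℕ a) % n          ≡⟨ cong (λ x → (x + toℕ a) % n) (toℕ-⊖ a) ⟩
    ((n ∸ toℕ a) % n + toℕ a) % n    ≡⟨ [m%n+k]%n≡[m+k]%n (n ∸ toℕ a) (toℕ a) ⟩
    (n ∸ toℕ a + toℕ a) % n          ≡⟨ cong (_% n) (m∸n+n≡m (<⇒≤ (toℕ<n a))) ⟩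
    n % n                            ≡⟨ n%n≡0 n ⟩
    0                                ≡⟨ toℕ-𝟘 ⟨
    toℕ 𝟘                            ∎)
    where open ≡-Reasoning

  abelianGroup : AbelianGroup 0ℓ 0ℓ
  abelianGroup = record
    { isAbelianGroup = record
      { isGroup = record
        { isMonoid = record
          { isSemigroup = record
            { isMagma = record { isEquivalence = isEquivalence ; ∙-cong = cong₂ _⊕_ }
            ; assoc = ⊕-assoc }
          ; identity = ⊕-identityˡ , λ a → trans (⊕-comm a 𝟘) (⊕-identityˡ a) }
        ; inverse = ⊖-inverseˡ , λ a → trans (⊕-comm a (⊖ a)) (⊖-inverseˡ a)
        ; ⁻¹-cong = cong ⊖_ }
      ; comm = ⊕-comm } }

  open AbelianGroup abelianGroup public
    using (_-_) renaming (identityʳ to ⊕-identityʳ; inverseʳ to ⊖-inverseʳ)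
  open AbelianGroupProperties abelianGroup public
  open CommutativeSemigroupProperties (AbelianGroup.commutativeSemigroup abelianGroup) public
    using (x∙yz≈yx∙z; xy∙z≈xz∙y)

  ∑-⊕ʳ : ∀ (f : Fin n → ℕ) c → ∑[ y < n ] f y ≡ ∑[ y < n ] f (y ⊕ c)
  ∑-⊕ʳ f c = ∑-reindex f (//-rightDividesˡ c) (//-rightDividesʳ c)

module ZnSets (n : ℕ) .{{_ : NonZero n}} where
  open Zn n
  open ZnGroup n

  eqb-sound : ∀ {a b} → eqb a b ≡ true → a ≡ b
  eqb-sound {a} {b} = witness (a FinP.≟ b)

  ∧-eqb : ∀ c {a b} → a ≡ b → c ∧ eqb a b ≡ c
  ∧-eqb c {a} refl = trans (cong (c ∧_) (dec-true (a FinP.≟ a) refl)) (∧-identityʳ c)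

  neg-char : ∀ A z → neg A z ≡ A (⊖ z)
  neg-char A z = trans (any-unique (∈-allFin (⊖ z)) preimage) (∧-eqb (A (⊖ z)) (sym (⁻¹-involutive z)))
    where
    preimage : ∀ b → A b ∧ eqb z (⊖ b) ≡ true → b ≡ ⊖ z
    preimage b e = trans (sym (⁻¹-involutive b)) (cong ⊖_ (sym (eqb-sound {z} {⊖ b} (∧-trueʳ {A b} e))))

  shift-char : ∀ c A z → shift c A z ≡ A (z - c)
  shift-char c A z = trans (any-unique (∈-allFin (z - c)) preimage) (∧-eqb (A (z - c)) (sym c+[z-c]≡z))
    where
    c+[z-c]≡z : c ⊕ (z - c) ≡ z
    c+[z-c]≡z = trans (⊕-comm c (z - c)) (//-rightDividesˡ c z)
    preimage : ∀ b → A b ∧ eqb z (c ⊕ b) ≡ true → b ≡ z - c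
    preimage b e = trans (sym (trans (cong (_- c) (⊕-comm c b)) (//-rightDividesʳ c b)))
                         (cong (_- c) (sym (eqb-sound {z} {c ⊕ b} (∧-trueʳ {A b} e))))

  sumset-char : ∀ A B z → sumset A B z ≡ any (λ a → A a ∧ B (z - a)) elems
  sumset-char A B z = any-cong (λ a → trans (any-∧ˡ (A a) _ elems) (cong (A a ∧_) (shift-char a B z))) elems

  sumset-periodic : ∀ A B {w} → (∀ b → B (b ⊕ w) ≡ B b) → ∀ z → sumset A B (z ⊕ w) ≡ sumset A B z
  sumset-periodic A B {w} B-periodic z = begin
    sumset A B (z ⊕ w)                      ≡⟨ sumset-char A B (z ⊕ w) ⟩
    any (λ a → A a ∧ B (z ⊕ w - a)) elems   ≡⟨ any-cong (λ a → cong (λ b → A a ∧ B b) (xy∙z≈xz∙y z w (⊖ a))) elems ⟩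
    any (λ a → A a ∧ B ((z - a) ⊕ w)) elems ≡⟨ any-cong (λ a → cong (A a ∧_) (B-periodic (z - a))) elems ⟩
    any (λ a → A a ∧ B (z - a)) elems       ≡⟨ sumset-char A B z ⟨
    sumset A B z                            ∎
    where open ≡-Reasoning

  card : Subset → ℕ
  card A = ∑[ z < n ] ⟦ A z ⟧

  mult± : Subset → Fin n → ℕ
  mult± A z = ⟦ A z ⟧ + ⟦ A (⊖ z) ⟧

  mult±-even : ∀ A z → mult± A (⊖ z) ≡ mult± A z
  mult±-even A z = trans (cong (λ x → ⟦ A (⊖ z) ⟧ + ⟦ A x ⟧) (⁻¹-involutive z)) (+-comm ⟦ A (⊖ z) ⟧ ⟦ A z ⟧)

module Multiples (n : ℕ) .{{_ : NonZero n}} (v : ℕ) .{{_ : NonZero v}} (v∣n : v ∣ n) where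
  open Zn n
  open ZnGroup n
  open ZnSets n

  vℤ : Subset
  vℤ z = does (v ∣? toℕ z)

  ∣toℕ-⊕⇔∣+ : ∀ a b → v ∣ toℕ (a ⊕ b) ⇔ v ∣ toℕ a + toℕ b
  ∣toℕ-⊕⇔∣+ a b = mk⇔ (λ v∣a⊕b → ∣n∣m%n⇒∣m v∣n (subst (v ∣_) (toℕ-⊕ a b) v∣a⊕b))
                      (λ v∣a+b → subst (v ∣_) (sym (toℕ-⊕ a b)) (%-presˡ-∣ v∣a+b v∣n))

  vℤ-𝟘 : vℤ 𝟘 ≡ true
  vℤ-𝟘 = dec-true (v ∣? toℕ 𝟘) (subst (v ∣_) (sym toℕ-𝟘) (v ∣0))

  vℤ-periodic : ∀ {w} → vℤ w ≡ true → ∀ b → vℤ (b ⊕ w) ≡ vℤ b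
  vℤ-periodic {w} w∈vℤ b = does-⇔ (mk⇔ to from) (v ∣? toℕ (b ⊕ w)) (v ∣? toℕ b)
    where
    v∣w : v ∣ toℕ w
    v∣w = witness (v ∣? toℕ w) w∈vℤ
    to : v ∣ toℕ (b ⊕ w) → v ∣ toℕ b
    to v∣b⊕w = ∣m+n∣m⇒∣n (subst (v ∣_) (+-comm (toℕ b) (toℕ w)) (Equivalence.to (∣toℕ-⊕⇔∣+ b w) v∣b⊕w)) v∣w
    from : v ∣ toℕ b → v ∣ toℕ (b ⊕ w)
    from v∣b = Equivalence.from (∣toℕ-⊕⇔∣+ b w) (∣m∣n⇒∣m+n v∣b v∣w)

  multiples-char : ∀ z → multiples v z ≡ vℤ z
  multiples-char z = ⇔→≡ {z = true} (mk⇔ to from)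
    where
    to : multiples v z ≡ true → vℤ z ≡ true
    to z∈ with any-witness (λ m → eqb z [ v * m ]) (upTo n) z∈
    ... | m , z≡[vm] = dec-true (v ∣? toℕ z)
      (subst (v ∣_) (sym (trans (cong toℕ (eqb-sound {z} z≡[vm])) (toℕ-[] (v * m)))) (%-presˡ-∣ (m∣m*n m) v∣n))
    from : vℤ z ≡ true → multiples v z ≡ true
    from z∈vℤ with witness (v ∣? toℕ z) z∈vℤ
    ... | divides k z≡kv = any-true (∈-upTo⁺ k<n) (∧-eqb true z≡[vk])
      where
      k<n : k < n
      k<n = ≤-<-trans (subst (k ≤_) (sym z≡kv) (m≤m*n k v)) (toℕ<n z)
      z≡[vk] : z ≡ [ v * k ]
      z≡[vk] = toℕ-injective (sym (begin
        toℕ [ v * k ]  ≡⟨ toℕ-[] (v * k) ⟩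
        v * k % n      ≡⟨ cong (_% n) (trans (*-comm v k) (sym z≡kv)) ⟩
        toℕ z % n      ≡⟨ m<n⇒m%n≡m (toℕ<n z) ⟩
        toℕ z          ∎))
        where open ≡-Reasoning

  ∑-vℤ : ∀ l → n ≡ v * l → ∑[ z < n ] ⟦ vℤ z ⟧ ≡ l
  ∑-vℤ l n≡vl = subst (λ m → ∑[ i < m ] ⟦ does (v ∣? toℕ i) ⟧ ≡ l) (sym n≡vl)
    (subst (λ w → ∑[ i < w * l ] ⟦ does (w ∣? toℕ i) ⟧ ≡ l) (suc-pred v) (∑-divisible (pred v) l))

  module HalfOf (q : ℕ) (v≡q*2 : v ≡ q * 2) where

    h : Fin n
    h = [ v / 2 ]

    private instance
      q≢0 : NonZero q
      q≢0 = ≢-nonZero λ q≡0 → ≢-nonZero⁻¹ v (trans v≡q*2 (cong (_* 2) q≡0))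

    q<v : q < v
    q<v = subst (q <_) (sym v≡q*2) (m<m*n q 2 (s≤s (s≤s z≤n)))

    toℕ-h : toℕ h ≡ q
    toℕ-h = begin
      toℕ [ v / 2 ]   ≡⟨ toℕ-[] (v / 2) ⟩
      v / 2 % n       ≡⟨ cong (λ x → x / 2 % n) v≡q*2 ⟩
      q * 2 / 2 % n   ≡⟨ cong (_% n) (m*n/n≡m q 2) ⟩
      q % n           ≡⟨ m<n⇒m%n≡m (<-≤-trans q<v (∣⇒≤ v∣n)) ⟩
      q               ∎
      where open ≡-Reasoning

    h∉vℤ : vℤ h ≡ false
    h∉vℤ = dec-false (v ∣? toℕ h) (subst (λ x → ¬ v ∣ x) (sym toℕ-h) (>⇒∤ q<v))

    h⊕h∈vℤ : vℤ (h ⊕ h) ≡ true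
    h⊕h∈vℤ = dec-true (v ∣? toℕ (h ⊕ h)) (Equivalence.from (∣toℕ-⊕⇔∣+ h h) (subst (v ∣_) v≡h+h ∣-refl))
      where
      v≡h+h : v ≡ toℕ h + toℕ h
      v≡h+h = trans v≡q*2 (trans (*-comm q 2) (trans (cong (q +_) (+-identityʳ q)) (sym (cong₂ _+_ toℕ-h toℕ-h))))

module DihedralWalks (n : ℕ) .{{_ : NonZero n}} where
  open Zn n
  open ZnGroup n
  open ZnSets n using (card; mult±; mult±-even)
  open Dihedral n

  -- the rotation index of (x^i a^s)⁻¹ x^j a^t, which alone decides adjacency in Dih(n, X, X)
  offset : Bool → Fin n → Fin n → Fin n
  offset false i j = (⊖ i) ⊕ j
  offset true  i j = i - j

  unoffset : Bool → Fin n → Fin n → Fin n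
  unoffset false i y = i ⊕ y
  unoffset true  i y = i - y

  x-[x-y]≡y : ∀ x y → x - (x - y) ≡ y
  x-[x-y]≡y x y = begin
    x ⊕ (⊖ (x - y))   ≡⟨ cong (x ⊕_) (⁻¹-anti-homo‿- x y) ⟩
    x ⊕ (y - x)       ≡⟨ ⊕-assoc x y (⊖ x) ⟨
    (x ⊕ y) - x       ≡⟨ xyx⁻¹≈y x y ⟩
    y                 ∎
    where open ≡-Reasoning

  offset-unoffset : ∀ s i y → offset s i (unoffset s i y) ≡ y
  offset-unoffset false = \\-leftDividesʳ
  offset-unoffset true  = x-[x-y]≡y

  unoffset-offset : ∀ s i m → unoffset s i (offset s i m) ≡ m
  unoffset-offset false = \\-leftDividesˡ
  unoffset-offset true  = x-[x-y]≡y

  offset-diagonal : ∀ s i → offset s i i ≡ 𝟘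
  offset-diagonal false = ⊖-inverseˡ
  offset-diagonal true  = ⊖-inverseʳ

  adj-offset : ∀ X s i t j → DihAdj X X (i , s) (j , t) ≡ X (offset s i j)
  adj-offset X false i false j = refl
  adj-offset X false i true  j = refl
  adj-offset X true  i false j = refl
  adj-offset X true  i true  j = refl

  ∑-offset : ∀ (f : Fin n → ℕ) s i → ∑[ j < n ] f (offset s i j) ≡ ∑[ y < n ] f y
  ∑-offset f s i = sym (∑-reindex f (offset-unoffset s i) (unoffset-offset s i))

  ∑-offset-convolution : ∀ (f g : Fin n → ℕ) → (∀ w → g (⊖ w) ≡ g w) → ∀ s i j →
    ∑[ m < n ] (f (offset s i m) * g (m - j)) ≡ ∑[ y < n ] (f y * g (y - offset s i j))
  ∑-offset-convolution f g g-even s i j = begin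
    ∑[ m < n ] (f (offset s i m) * g (m - j))
      ≡⟨ ∑-reindex _ (unoffset-offset s i) (offset-unoffset s i) ⟩
    ∑[ y < n ] (f (offset s i (unoffset s i y)) * g (unoffset s i y - j))
      ≡⟨ ∑-cong {n} (λ y → cong₂ _*_ (cong f (offset-unoffset s i y)) (g-unoffset s y)) ⟩
    ∑[ y < n ] (f y * g (y - offset s i j))
      ∎
    where
    open ≡-Reasoning
    g-unoffset : ∀ s y → g (unoffset s i y - j) ≡ g (y - offset s i j)
    g-unoffset false y = cong g (begin
      (i ⊕ y) - j          ≡⟨ x∙yz≈yx∙z y i (⊖ j) ⟨
      y ⊕ (i - j)          ≡⟨ cong (λ x → y ⊕ (x ⊕ (⊖ j))) (⁻¹-involutive i) ⟨
      y ⊕ ((⊖ (⊖ i)) - j)  ≡⟨ cong (y ⊕_) (⁻¹-∙-comm (⊖ i) j) ⟩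
      y - ((⊖ i) ⊕ j)      ∎)
    g-unoffset true y = trans (cong g (begin
      (i - y) - j          ≡⟨ xy∙z≈xz∙y i (⊖ y) (⊖ j) ⟩
      (i - j) - y          ≡⟨ ⁻¹-anti-homo‿- y (i - j) ⟨
      ⊖ (y - (i - j))      ∎)) (g-even (y - (i - j)))

  count-elemsD : ∀ (p : D → Bool) → count p elemsD ≡ ∑[ i < n ] ⟦ p (i , false) ⟧ + ∑[ i < n ] ⟦ p (i , true) ⟧
  count-elemsD p = begin
    count p (map (_, false) (allFin n) ++ map (_, true) (allFin n))
      ≡⟨ count-++ p (map (_, false) (allFin n)) (map (_, true) (allFin n)) ⟩
    count p (map (_, false) (allFin n)) + count p (map (_, true) (allFin n))
      ≡⟨ cong₂ (λ xs ys → count p xs + count p ys) (map-tabulate id (_, false)) (map-tabulate id (_, true)) ⟩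
    count p (tabulate (_, false)) + count p (tabulate (_, true))
      ≡⟨ cong₂ _+_ (count-tabulate p (_, false)) (count-tabulate p (_, true)) ⟩
    ∑[ i < n ] ⟦ p (i , false) ⟧ + ∑[ i < n ] ⟦ p (i , true) ⟧
      ∎
    where open ≡-Reasoning

  length-elemsD : length elemsD ≡ 2 * n
  length-elemsD = begin
    length (map (_, false) (allFin n) ++ map (_, true) (allFin n))
      ≡⟨ length-++ (map (_, false) (allFin n)) ⟩
    length (map (_, false) (allFin n)) + length (map (_, true) (allFin n))
      ≡⟨ cong₂ _+_ (length-map (_, false) (allFin n)) (length-map (_, true) (allFin n)) ⟩
    length (allFin n) + length (allFin n)
      ≡⟨ cong (λ m → m + m) (length-tabulate {n = n} id) ⟩
    n + n
      ≡⟨ cong (n +_) (+-identityʳ n) ⟨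
    2 * n
      ∎
    where open ≡-Reasoning

  module _ (X : Subset) where

    out-degree : ∀ u → count (DihAdj X X u) elemsD ≡ card X + card X
    out-degree (i , s) = trans (count-elemsD (DihAdj X X (i , s))) (cong₂ _+_ (half false) (half true))
      where
      half : ∀ t → ∑[ j < n ] ⟦ DihAdj X X (i , s) (j , t) ⟧ ≡ card X
      half t = trans (∑-cong {n} (λ j → cong ⟦_⟧ (adj-offset X s i t j))) (∑-offset (λ y → ⟦ X y ⟧) s i)

    in-degree : ∀ w → count (λ u → DihAdj X X u w) elemsD ≡ card X + card X
    in-degree (j , t) = trans (count-elemsD (λ u → DihAdj X X u (j , t))) (cong₂ _+_
      (trans (∑-cong {n} (λ m → cong ⟦_⟧ (trans (adj-offset X false m t j) (cong X (⊕-comm (⊖ m) j)))))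
             (∑-offset (λ y → ⟦ X y ⟧) true j))
      (trans (∑-cong {n} (λ m → cong ⟦_⟧ (trans (adj-offset X true m t j) (cong X (⊕-comm m (⊖ j))))))
             (∑-offset (λ y → ⟦ X y ⟧) false j)))

    two-step-walks : ∀ s i t j → count (λ z → DihAdj X X (i , s) z ∧ DihAdj X X z (j , t)) elemsD
                        ≡ ∑[ y < n ] (⟦ X y ⟧ * mult± X (y - offset s i j))
    two-step-walks s i t j = begin
      count (λ z → DihAdj X X (i , s) z ∧ DihAdj X X z (j , t)) elemsD
        ≡⟨ count-elemsD _ ⟩
      ∑[ m < n ] ⟦ DihAdj X X (i , s) (m , false) ∧ DihAdj X X (m , false) (j , t) ⟧
        + ∑[ m < n ] ⟦ DihAdj X X (i , s) (m , true) ∧ DihAdj X X (m , true) (j , t) ⟧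
        ≡⟨ cong₂ _+_ (∑-cong {n} (via false)) (∑-cong {n} (via true)) ⟩
      ∑[ m < n ] (⟦ X (offset s i m) ⟧ * ⟦ X ((⊖ m) ⊕ j) ⟧) + ∑[ m < n ] (⟦ X (offset s i m) ⟧ * ⟦ X (m - j) ⟧)
        ≡⟨ ∑-distrib-+ (λ m → ⟦ X (offset s i m) ⟧ * ⟦ X ((⊖ m) ⊕ j) ⟧) (λ m → ⟦ X (offset s i m) ⟧ * ⟦ X (m - j) ⟧) ⟨
      ∑[ m < n ] (⟦ X (offset s i m) ⟧ * ⟦ X ((⊖ m) ⊕ j) ⟧ + ⟦ X (offset s i m) ⟧ * ⟦ X (m - j) ⟧)
        ≡⟨ ∑-cong {n} (λ m → trans (sym (*-distribˡ-+ ⟦ X (offset s i m) ⟧ _ _)) (cong (⟦ X (offset s i m) ⟧ *_) (both-halves m))) ⟩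
      ∑[ m < n ] (⟦ X (offset s i m) ⟧ * mult± X (m - j))
        ≡⟨ ∑-offset-convolution (λ y → ⟦ X y ⟧) (mult± X) (mult±-even X) s i j ⟩
      ∑[ y < n ] (⟦ X y ⟧ * mult± X (y - offset s i j))
        ∎
      where
      open ≡-Reasoning
      via : ∀ r m → ⟦ DihAdj X X (i , s) (m , r) ∧ DihAdj X X (m , r) (j , t) ⟧
                    ≡ ⟦ X (offset s i m) ⟧ * ⟦ X (offset r m j) ⟧
      via r m = trans (cong₂ (λ a b → ⟦ a ∧ b ⟧) (adj-offset X s i r m) (adj-offset X r m t j)) (⟦⟧-∧ (X (offset s i m)) (X (offset r m j)))
      both-halves : ∀ m → ⟦ X ((⊖ m) ⊕ j) ⟧ + ⟦ X (m - j) ⟧ ≡ mult± X (m - j)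
      both-halves m = trans (+-comm ⟦ X ((⊖ m) ⊕ j) ⟧ ⟦ X (m - j) ⟧)
        (cong (λ x → ⟦ X (m - j) ⟧ + ⟦ X x ⟧) (sym (trans (⁻¹-anti-homo‿- m j) (⊕-comm j (⊖ m)))))

module _ (n : ℕ) .{{_ : NonZero n}} where
  open Zn n
  open ZnGroup n
  open ZnSets n using (card; mult±)
  open Dihedral n
  open DihedralWalks n

  -- M stands for vℤ_n and h for v/2; these are the only properties of them that are used.
  module HalfTurnConstruction
    (M : Subset) (h : Fin n) (l : ℕ)
    (𝟘∈M : M 𝟘 ≡ true) (M-periodic : ∀ {w} → M w ≡ true → ∀ b → M (b ⊕ w) ≡ M b)
    (h∉M : M h ≡ false) (h⊕h∈M : M (h ⊕ h) ≡ true) (card-M : card M ≡ l)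
    (X : Subset)
    (X-periodic : ∀ {w} → M w ≡ true → ∀ z → X (z ⊕ w) ≡ X z)
    (X-⊎-⊖X : ∀ z → mult± X z ≡ ⟦ not (M z) ⟧ + ⟦ M (z - h) ⟧)
    (X-∪-h+X : ∀ z → (X z ∨ X (z - h)) ≡ true)
    where

    M-h-coset : ∀ y → M (y - h) ≡ M (y ⊕ h)
    M-h-coset y = trans (sym (M-periodic h⊕h∈M (y - h))) (cong M (begin
      (y - h) ⊕ (h ⊕ h)    ≡⟨ ⊕-assoc y (⊖ h) (h ⊕ h) ⟩
      y ⊕ ((⊖ h) ⊕ (h ⊕ h)) ≡⟨ cong (y ⊕_) (\\-leftDividesʳ h h) ⟩
      y ⊕ h                ∎))
      where open ≡-Reasoning

    X-𝟘 : X 𝟘 ≡ false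
    X-𝟘 = ⟦⟧≡0 (m+n≡0⇒m≡0 ⟦ X 𝟘 ⟧ (begin
      mult± X 𝟘                     ≡⟨ X-⊎-⊖X 𝟘 ⟩
      ⟦ not (M 𝟘) ⟧ + ⟦ M (𝟘 - h) ⟧ ≡⟨ cong₂ (λ a b → ⟦ not a ⟧ + ⟦ b ⟧) 𝟘∈M ⊖h∉M ⟩
      0                             ∎))
      where
      open ≡-Reasoning
      ⊖h∉M : M (𝟘 - h) ≡ false
      ⊖h∉M = trans (M-h-coset 𝟘) (trans (cong M (⊕-identityˡ h)) h∉M)

    X∩M≡∅ : ∀ {a} → X a ≡ true → M a ≡ false
    X∩M≡∅ {a} a∈X = ¬-not λ a∈M →
      case trans (sym a∈X) (trans (cong X (sym (⊕-identityˡ a))) (trans (X-periodic a∈M 𝟘) X-𝟘)) of λ ()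

    X-⊖ : ∀ {y} → X y ≡ true → X (⊖ y) ≡ M (y - h)
    X-⊖ {y} y∈X = ⟦⟧-injective (+-cancelˡ-≡ 1 ⟦ X (⊖ y) ⟧ ⟦ M (y - h) ⟧ (begin
      1 + ⟦ X (⊖ y) ⟧               ≡⟨ cong (λ b → ⟦ b ⟧ + ⟦ X (⊖ y) ⟧) y∈X ⟨
      mult± X y                     ≡⟨ X-⊎-⊖X y ⟩
      ⟦ not (M y) ⟧ + ⟦ M (y - h) ⟧ ≡⟨ cong (λ b → ⟦ not b ⟧ + ⟦ M (y - h) ⟧) (X∩M≡∅ y∈X) ⟩
      1 + ⟦ M (y - h) ⟧             ∎))
      where open ≡-Reasoning

    X-⊕h : ∀ y → X (y ⊕ h) ≡ not (X y)
    X-⊕h y with X y in y∈X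
    ... | false = trans (sym (∨-identityʳ (X (y ⊕ h))))
                        (trans (cong (X (y ⊕ h) ∨_) (sym (trans (cong X (//-rightDividesʳ h y)) y∈X))) (X-∪-h+X (y ⊕ h)))
    ... | true  = ¬-not λ y⊕h∈X →
      case trans (sym (X-∪-h+X (⊖ y))) (cong₂ _∨_ (⊖y∉X y⊕h∈X) (⊖y-h∉X y⊕h∈X)) of λ ()
      where
      ⊖y∉X : X (y ⊕ h) ≡ true → X (⊖ y) ≡ false
      ⊖y∉X y⊕h∈X = trans (X-⊖ y∈X) (trans (M-h-coset y) (X∩M≡∅ y⊕h∈X))
      ⊖y-h∉X : X (y ⊕ h) ≡ true → X ((⊖ y) - h) ≡ false
      ⊖y-h∉X y⊕h∈X = trans (cong X (⁻¹-∙-comm y h))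
        (trans (X-⊖ y⊕h∈X) (trans (cong M (//-rightDividesʳ h y)) (X∩M≡∅ y∈X)))

    card-X+card-X : card X + card X ≡ n
    card-X+card-X = begin
      card X + card X                                ≡⟨ cong (card X +_) (∑-⊕ʳ (λ y → ⟦ X y ⟧) h) ⟩
      card X + ∑[ y < n ] ⟦ X (y ⊕ h) ⟧               ≡⟨ cong (card X +_) (∑-cong {n} (λ y → cong ⟦_⟧ (X-⊕h y))) ⟩
      card X + ∑[ y < n ] ⟦ not (X y) ⟧               ≡⟨ ∑-distrib-+ (λ y → ⟦ X y ⟧) (λ y → ⟦ not (X y) ⟧) ⟨
      ∑[ y < n ] (⟦ X y ⟧ + ⟦ not (X y) ⟧)           ≡⟨ ∑-cong {n} (λ y → ⟦⟧-+-not (X y)) ⟩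
      ∑[ y < n ] 1                                   ≡⟨ ∑-const-1 n ⟩
      n                                              ∎
      where open ≡-Reasoning

    ∑-X-M : ∀ c → ∑[ y < n ] (⟦ X y ⟧ * ⟦ M (y - c) ⟧) ≡ ⟦ X c ⟧ * l
    ∑-X-M c = begin
      ∑[ y < n ] (⟦ X y ⟧ * ⟦ M (y - c) ⟧)             ≡⟨ ∑-⊕ʳ (λ y → ⟦ X y ⟧ * ⟦ M (y - c) ⟧) c ⟩
      ∑[ y < n ] (⟦ X (y ⊕ c) ⟧ * ⟦ M ((y ⊕ c) - c) ⟧) ≡⟨ ∑-cong {n} (λ y → cong (λ x → ⟦ X (y ⊕ c) ⟧ * ⟦ M x ⟧) (//-rightDividesʳ c y)) ⟩
      ∑[ y < n ] (⟦ X (y ⊕ c) ⟧ * ⟦ M y ⟧)             ≡⟨ ∑-cong {n} on-M ⟩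
      ∑[ y < n ] (⟦ X c ⟧ * ⟦ M y ⟧)                   ≡⟨ ∑-*ˡ ⟦ X c ⟧ (λ y → ⟦ M y ⟧) ⟩
      ⟦ X c ⟧ * card M                                 ≡⟨ cong (⟦ X c ⟧ *_) card-M ⟩
      ⟦ X c ⟧ * l                                      ∎
      where
      open ≡-Reasoning
      on-M : ∀ y → ⟦ X (y ⊕ c) ⟧ * ⟦ M y ⟧ ≡ ⟦ X c ⟧ * ⟦ M y ⟧
      on-M y with M y in y∈M
      ... | true  = cong (λ b → ⟦ b ⟧ * 1) (trans (cong X (⊕-comm y c)) (X-periodic y∈M c))
      ... | false = trans (*-zeroʳ ⟦ X (y ⊕ c) ⟧) (sym (*-zeroʳ ⟦ X c ⟧))

    convolution-identity : ∀ c → ∑[ y < n ] (⟦ X y ⟧ * mult± X (y - c)) + ⟦ X c ⟧ * l ≡ card X + ⟦ not (X c) ⟧ * l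
    convolution-identity c = begin
      ∑[ y < n ] (⟦ X y ⟧ * mult± X (y - c)) + C
        ≡⟨ cong (_+ C) (trans (∑-cong {n} (λ y → trans (cong (⟦ X y ⟧ *_) (X-⊎-⊖X (y - c))) (*-distribˡ-+ ⟦ X y ⟧ _ _)))
                              (∑-distrib-+ (λ y → ⟦ X y ⟧ * ⟦ not (M (y - c)) ⟧) (λ y → ⟦ X y ⟧ * ⟦ M (y - c - h) ⟧))) ⟩
      (A + B) + C    ≡⟨ +-assoc A B C ⟩
      A + (B + C)    ≡⟨ cong (A +_) (+-comm B C) ⟩
      A + (C + B)    ≡⟨ +-assoc A C B ⟨
      (A + C) + B    ≡⟨ cong₂ _+_ A+C≡card-X B≡ ⟩
      card X + ⟦ X (c ⊕ h) ⟧ * l    ≡⟨ cong (λ b → card X + ⟦ b ⟧ * l) (X-⊕h c) ⟩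
      card X + ⟦ not (X c) ⟧ * l    ∎
      where
      open ≡-Reasoning
      A B C : ℕ
      A = ∑[ y < n ] (⟦ X y ⟧ * ⟦ not (M (y - c)) ⟧)
      B = ∑[ y < n ] (⟦ X y ⟧ * ⟦ M (y - c - h) ⟧)
      C = ⟦ X c ⟧ * l
      A+C≡card-X : A + C ≡ card X
      A+C≡card-X = begin
        A + C       ≡⟨ cong (A +_) (∑-X-M c) ⟨
        A + ∑[ y < n ] (⟦ X y ⟧ * ⟦ M (y - c) ⟧)
          ≡⟨ ∑-distrib-+ (λ y → ⟦ X y ⟧ * ⟦ not (M (y - c)) ⟧) (λ y → ⟦ X y ⟧ * ⟦ M (y - c) ⟧) ⟨
        ∑[ y < n ] (⟦ X y ⟧ * ⟦ not (M (y - c)) ⟧ + ⟦ X y ⟧ * ⟦ M (y - c) ⟧)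
          ≡⟨ ∑-cong {n} (λ y → split ⟦ X y ⟧ (M (y - c))) ⟩
        card X      ∎
        where
        split : ∀ k b → k * ⟦ not b ⟧ + k * ⟦ b ⟧ ≡ k
        split k b = trans (sym (*-distribˡ-+ k ⟦ not b ⟧ ⟦ b ⟧))
                          (trans (cong (k *_) (trans (+-comm ⟦ not b ⟧ ⟦ b ⟧) (⟦⟧-+-not b))) (*-identityʳ k))
      B≡ : B ≡ ⟦ X (c ⊕ h) ⟧ * l
      B≡ = trans (∑-cong {n} (λ y → cong (λ x → ⟦ X y ⟧ * ⟦ M x ⟧) (trans (⊕-assoc y (⊖ c) (⊖ h)) (cong (y ⊕_) (⁻¹-∙-comm c h)))))
                 (∑-X-M (c ⊕ h))

    n/2≡card-X : n / 2 ≡ card X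
    n/2≡card-X = trans (cong (_/ 2) n≡card-X*2) (m*n/n≡m (card X) 2)
      where
      n≡card-X*2 : n ≡ card X * 2
      n≡card-X*2 = trans (sym card-X+card-X) (trans (cong (card X +_) (sym (+-identityʳ (card X)))) (*-comm 2 (card X)))

    loopless : ∀ u w → does (u ≟D w) ≡ true → DihAdj X X u w ≡ false
    loopless (i , s) w u≟w with witness ((i , s) ≟D w) u≟w
    ... | refl = trans (adj-offset X s i s i) (trans (cong X (offset-diagonal s i)) X-𝟘)

    two-step-walks-identity : ∀ u w → count (λ z → DihAdj X X u z ∧ DihAdj X X z w) elemsD + ⟦ DihAdj X X u w ⟧ * l
                                      ≡ n / 2 + ⟦ not (DihAdj X X u w) ⟧ * l
    two-step-walks-identity (i , s) (j , t)
      rewrite adj-offset X s i t j | two-step-walks X s i t j | n/2≡card-X = convolution-identity (offset s i j)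

    isDSRG : DihIsDSRG X X (2 * n) n (n / 2 + l) (n / 2 ∸ l) (n / 2 + l)
    isDSRG = length-elemsD
           , (λ u → trans (out-degree X u) card-X+card-X)
           , (λ w → trans (in-degree X w) card-X+card-X)
           , λ u w → dsrg-entry (does (u ≟D w)) (DihAdj X X u w) _ (n / 2) l (loopless u w) (two-step-walks-identity u w)

mainTheorem12 : (n : ℕ) .{{_ : NonZero n}} (v l : ℕ) →
    1 ≤ n → v ∣ n → 2 ∣ v → 2 < v → n ≡ v * l →
    (H X : Zn.Subset n) →
    ((z : Fin n) → H z ≡ true → (1 ≤ toℕ z) × (toℕ z ≤ v ∸ 1)) →
    ((z : Fin n) → X z ≡ Zn.sumset n H (Zn.multiples n v) z) →
    ((z : Fin n) →
      Zn.mult n X z + Zn.mult n (Zn.neg n X) z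
        ≡ Zn.mult n (Zn.compl n (Zn.multiples n v)) z
          + Zn.mult n (Zn.shift n (Zn.[_] n (v / 2)) (Zn.multiples n v)) z) →
    ((z : Fin n) → (X z ∨ Zn.shift n (Zn.[_] n (v / 2)) X z) ≡ true) →
    Dihedral.DihIsDSRG n X X (2 * n) n (n / 2 + l) (n / 2 ∸ l) (n / 2 + l)
mainTheorem12 n v l _ v∣n (divides q v≡q*2) 2<v n≡v*l H X _ X≡H+vℤ X⊎-X≡ X∪h+X≡ =
  HalfTurnConstruction.isDSRG n vℤ h l vℤ-𝟘 vℤ-periodic h∉vℤ h⊕h∈vℤ (∑-vℤ l n≡v*l) X X-periodic X-⊎-⊖X X-∪-h+X
  where
  instance
    v≢0 : NonZero v
    v≢0 = >-nonZero (<-trans (s≤s z≤n) 2<v)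
  open Zn n
  open ZnGroup n
  open ZnSets n
  open Multiples n v v∣n
  open HalfOf q v≡q*2

  X-periodic : ∀ {w} → vℤ w ≡ true → ∀ z → X (z ⊕ w) ≡ X z
  X-periodic {w} w∈vℤ z = trans (X≡H+vℤ (z ⊕ w)) (trans (sumset-periodic H (multiples v) vℤ-periodic′ z) (sym (X≡H+vℤ z)))
    where
    vℤ-periodic′ : ∀ b → multiples v (b ⊕ w) ≡ multiples v b
    vℤ-periodic′ b = trans (multiples-char (b ⊕ w)) (trans (vℤ-periodic w∈vℤ b) (sym (multiples-char b)))

  X-⊎-⊖X : ∀ z → ⟦ X z ⟧ + ⟦ X (⊖ z) ⟧ ≡ ⟦ not (vℤ z) ⟧ + ⟦ vℤ (z - h) ⟧
  X-⊎-⊖X z = trans (cong (λ b → ⟦ X z ⟧ + ⟦ b ⟧) (sym (neg-char X z))) (trans (X⊎-X≡ z)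
    (cong₂ (λ a b → ⟦ not a ⟧ + ⟦ b ⟧) (multiples-char z) (trans (shift-char h (multiples v) z) (multiples-char (z - h)))))

  X-∪-h+X : ∀ z → (X z ∨ X (z - h)) ≡ true
  X-∪-h+X z = trans (cong (X z ∨_) (sym (shift-char h X z))) (X∪h+X≡ z)
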